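{- The canonical structure $\mathbb{M}=(\mathbb{G},V)$ is a graph-based $\mathbf{A}$-model; i.e.\ for every $p\in\mathsf{Prop}$: (1) $[\![p]\!]_P^{[1]}=(\![p]\!)_P$ and $[\![p]\!]_P=(\![p]\!)_P^{[0]}$; (2) $[\![p]\!]_S^{[1]}=(\![p]\!)_S$ and $[\![p]\!]_S=(\![p]\!)_S^{[0]}$.
   Context: $\mathbf{A}$ is a complete, frame-distributive and dually frame-distributive commutative residuated lattice. $(\mathbf{SD},\mathbf{PP},\lozenge,\Diamond)$ is the Lindenbaum–Tarski heterogeneous algebra of the basic multi-type normal logic (two lattices of formulas of types SD and PP, with normal $\Diamond:\mathbf{PP}\to\mathbf{SD}$, $\lozenge:\mathbf{SD}\to\mathbf{PP}$); formulas are identified with their classes. For a lattice $\mathbb{L}$, a proper $\mathbf{A}$-filter is $f:\mathbb{L}\to\mathbf{A}$ with $f(\top)=1$, $f(\bot)=0$, $f(a\wedge b)=f(a)\wedge f(b)$; a complement of a proper $\mathbf{A}$-ideal is $u:\mathbb{L}\to\mathbf{A}$ with $u(\bot)=0$, $u(\top)=1$, $u(a\vee b)=u(a)\vee u(b)$. Canonical frame: $Z^S$ is the set of pairs $z=(f_z,u_z)$ of a proper $\mathbf{A}$-filter and a complement of a proper $\mathbf{A}$-ideal on $\mathbf{PP}$ with $\bigwedge_{\pi}(f_z(\pi)\to u_z(\pi))=1$; $Z^P$ is the set of analogous pairs $z=(g_z,v_z)$ on $\mathbf{SD}$. $E_S(z,z')=\bigwedge_{\pi\in\mathbf{PP}}(f_z(\pi)\to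 u_{z'}(\pi))$, $E_P(z,z')=\bigwedge_{\sigma\in\mathbf{SD}}(g_z(\sigma)\to v_{z'}(\sigma))$, $R_\Diamond(z,z')=\bigwedge_{\pi}(f_{z'}(\pi)\to v_z(\Diamond\pi))$ for $z\in Z^P,z'\in Z^S$, $R_\lozenge(z,z')=\bigwedge_{\sigma}(g_{z'}(\sigma)\to u_z(\lozenge\sigma))$ for $z\in Z^S,z'\in Z^P$. In this setting, for a graph $(Z,E)$ one uses $Z_A:=Z$, $Z_X:=\mathbf{A}\times Z$, and for $f:Z\to\mathbf{A}$, $u:\mathbf{A}\times Z\to\mathbf{A}$: $f^{[1]}(\alpha,z)=\bigwedge_{z'\in Z}[f(z')\to(E(z',z)\to\alpha)]$, $u^{[0]}(z)=\bigwedge_{(\alpha,z')\in\mathbf{A}\times Z}[u(\alpha,z')\to(E(z,z')\to\alpha)]$. Canonical valuation: $[\![p]\!]_P:Z^S\to\mathbf{A}$, $z\mapsto f_z(p)$ and $(\![p]\!)_P:\mathbf{A}\times Z^S\to\mathbf{A}$, $(\alpha,z)\mapsto u_z(p)\to\alpha$; $[\![p]\!]_S:Z^P\to\mathbf{A}$, $z\mapsto g_z(p)$ and $(\![p]\!)_S:\mathbf{A}\times Z^P\to\mathbf{A}$, $(\alpha,z)\mapsto v_z(p)\to\alpha$ (with $[0],[1]$ computed w.r.t.\ $E_S$, resp.\ $E_P$). -}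

module Defs where

open import Data.Product using (_×_; _,_; proj₁; proj₂)
open import Relation.Binary.PropositionalEquality using (_≡_)

record CRL : Set₁ where
  infixr 6 _∨_
  infixr 7 _∧_
  infixr 7 _⊗_
  infixr 5 _⇒_
  infix 4 _≤_
  field
    Carrier : Set
    _≤_     : Carrier → Carrier → Set
    ≤-refl    : ∀ {a} → a ≤ a
    ≤-trans   : ∀ {a b c} → a ≤ b → b ≤ c → a ≤ c
    ≤-antisym : ∀ {a b} → a ≤ b → b ≤ a → a ≡ b
    _∧_ : Carrier → Carrier → Carrier
    _∨_ : Carrier → Carrier → Carrier
    ∧-lb₁ : ∀ a b → a ∧ b ≤ a
    ∧-lb₂ : ∀ a b → a ∧ b ≤ b
    ∧-glb : ∀ {a b c} → c ≤ a → c ≤ b → c ≤ a ∧ b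
    ∨-ub₁ : ∀ a b → a ≤ a ∨ b
    ∨-ub₂ : ∀ a b → b ≤ a ∨ b
    ∨-lub : ∀ {a b c} → a ≤ c → b ≤ c → a ∨ b ≤ c
    0#    : Carrier
    0-min : ∀ a → 0# ≤ a
    _⊗_   : Carrier → Carrier → Carrier
    1#    : Carrier
    ⊗-assoc : ∀ a b c → (a ⊗ b) ⊗ c ≡ a ⊗ (b ⊗ c)
    ⊗-comm  : ∀ a b → a ⊗ b ≡ b ⊗ a
    ⊗-unit  : ∀ a → 1# ⊗ a ≡ a
    _⇒_     : Carrier → Carrier → Carrier
    resid→  : ∀ {a b c} → a ⊗ b ≤ c → b ≤ a ⇒ c
    resid←  : ∀ {a b c} → b ≤ a ⇒ c → a ⊗ b ≤ c
    ⋀ : {I : Set} → (I → Carrier) → Carrier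
    ⋁ : {I : Set} → (I → Carrier) → Carrier
    ⋀-lb  : ∀ {I : Set} (g : I → Carrier) (i : I) → ⋀ g ≤ g i
    ⋀-glb : ∀ {I : Set} (g : I → Carrier) {c} → (∀ i → c ≤ g i) → c ≤ ⋀ g
    ⋁-ub  : ∀ {I : Set} (g : I → Carrier) (i : I) → g i ≤ ⋁ g
    ⋁-lub : ∀ {I : Set} (g : I → Carrier) {c} → (∀ i → g i ≤ c) → ⋁ g ≤ c

module _ (A : CRL) where
  open CRL A

  FrameDistributive : Set₁
  FrameDistributive = ∀ {I : Set} (a : Carrier) (b : I → Carrier) →
    a ∧ ⋁ b ≡ ⋁ (λ i → a ∧ b i)

  DuallyFrameDistributive : Set₁
  DuallyFrameDistributive = ∀ {I : Set} (a : Carrier) (b : I → Carrier) →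
    a ∨ ⋀ b ≡ ⋀ (λ i → a ∨ b i)

-- Formulas of the basic multi-type normal logic (types SD and PP),
-- over a set Prop of proposition letters (available in both types).

module _ (Prop : Set) where

  infixr 6 _∨S_ _∨P_
  infixr 7 _∧S_ _∧P_

  data FmS : Set
  data FmP : Set

  data FmS where
    atS  : Prop → FmS
    ⊤S ⊥S : FmS
    _∧S_ _∨S_ : FmS → FmS → FmS
    ◇_   : FmP → FmS

  data FmP where
    atP  : Prop → FmP
    ⊤P ⊥P : FmP
    _∧P_ _∨P_ : FmP → FmP → FmP
    ◆_   : FmS → FmP

  infix 3 _⊢S_ _⊢P_

  data _⊢S_ : FmS → FmS → Set
  data _⊢P_ : FmP → FmP → Set

  data _⊢S_ where
    idS   : ∀ {a} → a ⊢S a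
    cutS  : ∀ {a b c} → a ⊢S b → b ⊢S c → a ⊢S c
    ⊤S-R  : ∀ {a} → a ⊢S ⊤S
    ⊥S-L  : ∀ {a} → ⊥S ⊢S a
    ∧S-L₁ : ∀ {a b} → a ∧S b ⊢S a
    ∧S-L₂ : ∀ {a b} → a ∧S b ⊢S b
    ∧S-R  : ∀ {a b c} → c ⊢S a → c ⊢S b → c ⊢S a ∧S b
    ∨S-R₁ : ∀ {a b} → a ⊢S a ∨S b
    ∨S-R₂ : ∀ {a b} → b ⊢S a ∨S b
    ∨S-L  : ∀ {a b c} → a ⊢S c → b ⊢S c → a ∨S b ⊢S c
    ◇-mono : ∀ {a b} → a ⊢P b → ◇ a ⊢S ◇ b
    ◇-⊥    : ◇ ⊥P ⊢S ⊥S
    ◇-∨    : ∀ {a b} → ◇ (a ∨P b) ⊢S ◇ a ∨S ◇ b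

  data _⊢P_ where
    idP   : ∀ {a} → a ⊢P a
    cutP  : ∀ {a b c} → a ⊢P b → b ⊢P c → a ⊢P c
    ⊤P-R  : ∀ {a} → a ⊢P ⊤P
    ⊥P-L  : ∀ {a} → ⊥P ⊢P a
    ∧P-L₁ : ∀ {a b} → a ∧P b ⊢P a
    ∧P-L₂ : ∀ {a b} → a ∧P b ⊢P b
    ∧P-R  : ∀ {a b c} → c ⊢P a → c ⊢P b → c ⊢P a ∧P b
    ∨P-R₁ : ∀ {a b} → a ⊢P a ∨P b
    ∨P-R₂ : ∀ {a b} → b ⊢P a ∨P b
    ∨P-L  : ∀ {a b c} → a ⊢P c → b ⊢P c → a ∨P b ⊢P c
    ◆-mono : ∀ {a b} → a ⊢S b → ◆ a ⊢P ◆ b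
    ◆-⊥    : ◆ ⊥S ⊢P ⊥P
    ◆-∨    : ∀ {a b} → ◆ (a ∨S b) ⊢P ◆ a ∨P ◆ b

-- Canonical frame.  Lindenbaum–Tarski algebras are represented as
-- formulas modulo interderivability: maps on classes = maps on formulas
-- that respect interderivability.

module _ (Prop : Set) (A : CRL) where
  open CRL A

  -- pairs (f_z , u_z) on PP : elements of Z^S
  record ZS : Set where
    field
      f u   : FmP Prop → Carrier
      f-resp : ∀ {a b} → _⊢P_ Prop a b → _⊢P_ Prop b a → f a ≡ f b
      u-resp : ∀ {a b} → _⊢P_ Prop a b → _⊢P_ Prop b a → u a ≡ u b
      f-⊤ : f (⊤P) ≡ 1#
      f-⊥ : f (⊥P) ≡ 0#
      f-∧ : ∀ a b → f (_∧P_ a b) ≡ f a ∧ f b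
      u-⊥ : u (⊥P) ≡ 0#
      u-⊤ : u (⊤P) ≡ 1#
      u-∨ : ∀ a b → u (_∨P_ a b) ≡ u a ∨ u b
      f⇒u : ⋀ (λ π → f π ⇒ u π) ≡ 1#

  -- pairs (g_z , v_z) on SD : elements of Z^P
  record ZP : Set where
    field
      g v   : FmS Prop → Carrier
      g-resp : ∀ {a b} → _⊢S_ Prop a b → _⊢S_ Prop b a → g a ≡ g b
      v-resp : ∀ {a b} → _⊢S_ Prop a b → _⊢S_ Prop b a → v a ≡ v b
      g-⊤ : g (⊤S) ≡ 1#
      g-⊥ : g (⊥S) ≡ 0#
      g-∧ : ∀ a b → g (_∧S_ a b) ≡ g a ∧ g b
      v-⊥ : v (⊥S) ≡ 0#
      v-⊤ : v (⊤S) ≡ 1#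
      v-∨ : ∀ a b → v (_∨S_ a b) ≡ v a ∨ v b
      g⇒v : ⋀ (λ σ → g σ ⇒ v σ) ≡ 1#

  ES : ZS → ZS → Carrier
  ES z z' = ⋀ (λ π → ZS.f z π ⇒ ZS.u z' π)

  EP : ZP → ZP → Carrier
  EP z z' = ⋀ (λ σ → ZP.g z σ ⇒ ZP.v z' σ)

  valP : Prop → ZS → Carrier
  valP p z = ZS.f z (atP p)

  covalP : Prop → Carrier × ZS → Carrier
  covalP p (α , z) = ZS.u z (atP p) ⇒ α

  valS : Prop → ZP → Carrier
  valS p z = ZP.g z (atS p)

  covalS : Prop → Carrier × ZP → Carrier
  covalS p (α , z) = ZP.v z (atS p) ⇒ α

-- The Galois maps (·)^[1] and (·)^[0] for a graph (Z, E), with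
-- Z_A = Z and Z_X = A × Z.

module _ (A : CRL) where
  open CRL A

  up1 : {Z : Set} → (Z → Z → Carrier) → (Z → Carrier) → Carrier × Z → Carrier
  up1 {Z} E f (α , z) = ⋀ (λ (z' : Z) → f z' ⇒ (E z' z ⇒ α))

  down0 : {Z : Set} → (Z → Z → Carrier) → (Carrier × Z → Carrier) → Z → Carrier
  down0 {Z} E u z = ⋀ (λ (x : Carrier × Z) → u x ⇒ (E z (proj₂ x) ⇒ proj₁ x))

module Submission where

-- For a bounded lattice logic call a pair (f , u) of a proper A-filter f and
-- the complement u of a proper A-ideal with ⋀π (f π ⇒ u π) = 1 a *pair*; the
-- canonical points of either type are exactly such pairs, and
-- E(z , z') = ⋀π (f_z π ⇒ u_z' π).  The two equations of the theorem are
--   ⋀z' (f_z' p ⇒ (E(z' , z) ⇒ α)) = u_z p ⇒ α   and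
--   f_z p = ⋀(α , z') ((u_z' p ⇒ α) ⇒ (E(z , z') ⇒ α)).
-- In both, "≥" resp. "≤" is modus ponens, since E(w , z) ≤ f_w p ⇒ u_z p.
-- The other inequality needs a witness point: for the first, the filter
-- generated by p at level u_z(p), paired with u_z; for the second, the
-- ideal generated by p at level f_z(p), paired with f_z.  That these are
-- again pairs is where (dual) frame distributivity of A is used.

open import Defs
open import Data.Product using (_×_; _,_; proj₁; proj₂; Σ)
open import Data.Sum using (_⊎_; inj₁; inj₂)
open import Data.Unit using (tt) renaming (⊤ to Unit)
open import Relation.Binary.PropositionalEquality using (_≡_; refl; sym)

module ResiduatedFacts (A : CRL) where
  open CRL A

  ≡⇒≤ : ∀ {a b} → a ≡ b → a ≤ b
  ≡⇒≤ refl = ≤-refl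

  modus-ponens : ∀ {a b} → a ⊗ (a ⇒ b) ≤ b
  modus-ponens = resid← ≤-refl

  ⊗-monoʳ : ∀ {a b b'} → b ≤ b' → a ⊗ b ≤ a ⊗ b'
  ⊗-monoʳ b≤b' = resid← (≤-trans b≤b' (resid→ ≤-refl))

  ⊗-monoˡ : ∀ {a a' b} → a ≤ a' → a ⊗ b ≤ a' ⊗ b
  ⊗-monoˡ {a} {a'} {b} a≤a' =
    ≤-trans (≡⇒≤ (⊗-comm a b)) (≤-trans (⊗-monoʳ a≤a') (≡⇒≤ (⊗-comm b a')))

  ⇒-monoʳ : ∀ {a b b'} → b ≤ b' → a ⇒ b ≤ a ⇒ b'
  ⇒-monoʳ b≤b' = resid→ (≤-trans modus-ponens b≤b')

  ⇒-antitoneˡ : ∀ {a a' b} → a' ≤ a → a ⇒ b ≤ a' ⇒ b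
  ⇒-antitoneˡ a'≤a = resid→ (≤-trans (⊗-monoˡ a'≤a) modus-ponens)

  ⇒-discharge : ∀ {a b} → 1# ≤ a → a ⇒ b ≤ b
  ⇒-discharge {a} {b} 1≤a =
    ≤-trans (≡⇒≤ (sym (⊗-unit (a ⇒ b)))) (≤-trans (⊗-monoˡ 1≤a) modus-ponens)

  ≤⇒1≤⇒ : ∀ {a b} → a ≤ b → 1# ≤ a ⇒ b
  ≤⇒1≤⇒ {a} a≤b = resid→ (≤-trans (≡⇒≤ (⊗-comm a 1#)) (≤-trans (≡⇒≤ (⊗-unit a)) a≤b))

  1≤⇒⇒≤ : ∀ {a b} → 1# ≤ a ⇒ b → a ≤ b
  1≤⇒⇒≤ {a} 1≤a⇒b = ≤-trans (≡⇒≤ (sym (⊗-unit a)))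
    (≤-trans (≡⇒≤ (⊗-comm 1# a)) (resid← 1≤a⇒b))

  chain : ∀ {e c b α} → e ≤ c ⇒ b → e ⊗ (c ⊗ (b ⇒ α)) ≤ α
  chain {e} {c} {b} {α} e≤c⇒b =
    ≤-trans (≡⇒≤ (sym (⊗-assoc e c (b ⇒ α))))
      (≤-trans (⊗-monoˡ e⊗c≤b) modus-ponens)
    where
    e⊗c≤b : e ⊗ c ≤ b
    e⊗c≤b = ≤-trans (⊗-monoˡ e≤c⇒b) (≤-trans (≡⇒≤ (⊗-comm (c ⇒ b) c)) modus-ponens)

  1≤⋀⇒ : ∀ {I : Set} {g h : I → Carrier} → (∀ i → g i ≤ h i) → 1# ≤ ⋀ (λ i → g i ⇒ h i)
  1≤⋀⇒ g≤h = ⋀-glb _ (λ i → ≤⇒1≤⇒ (g≤h i))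

  ⋀⇒≡1 : ∀ {I : Set} {g h : I → Carrier} → (∀ i → g i ≤ h i) →
         (i₀ : I) → g i₀ ≡ 1# → h i₀ ≡ 1# → ⋀ (λ i → g i ⇒ h i) ≡ 1#
  ⋀⇒≡1 g≤h i₀ gi₀≡1 hi₀≡1 = ≤-antisym
    (≤-trans (⋀-lb _ i₀) (≤-trans (⇒-discharge (≡⇒≤ (sym gi₀≡1))) (≡⇒≤ hi₀≡1)))
    (1≤⋀⇒ g≤h)

  ∧-comm≤ : ∀ {a b} → a ∧ b ≤ b ∧ a
  ∧-comm≤ = ∧-glb (∧-lb₂ _ _) (∧-lb₁ _ _)

  ∨-comm≤ : ∀ {a b} → a ∨ b ≤ b ∨ a
  ∨-comm≤ = ∨-lub (∨-ub₂ _ _) (∨-ub₁ _ _)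

  ⋁∧⋁≤⋁ : FrameDistributive A → ∀ {I J K : Set} {g : I → Carrier} {h : J → Carrier} {k : K → Carrier} →
          (∀ i j → Σ K (λ l → g i ∧ h j ≤ k l)) → ⋁ g ∧ ⋁ h ≤ ⋁ k
  ⋁∧⋁≤⋁ fd {g = g} {h} {k} bound =
    ≤-trans ∧-comm≤ (≤-trans (≡⇒≤ (fd (⋁ h) g)) (⋁-lub _ meet-with-joinand))
    where
    meet-with-joinand : ∀ i → ⋁ h ∧ g i ≤ ⋁ k
    meet-with-joinand i =
      ≤-trans ∧-comm≤ (≤-trans (≡⇒≤ (fd (g i) h))
        (⋁-lub _ (λ j → ≤-trans (proj₂ (bound i j)) (⋁-ub k (proj₁ (bound i j))))))

  ⋀≤⋀∨⋀ : DuallyFrameDistributive A → ∀ {I J K : Set} {g : I → Carrier} {h : J → Carrier} {k : K → Carrier} →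
          (∀ i j → Σ K (λ l → k l ≤ g i ∨ h j)) → ⋀ k ≤ ⋀ g ∨ ⋀ h
  ⋀≤⋀∨⋀ dfd {g = g} {h} {k} bound =
    ≤-trans (⋀-glb _ joinand-join-meet) (≤-trans (≡⇒≤ (sym (dfd (⋀ h) g))) ∨-comm≤)
    where
    joinand-join-meet : ∀ i → ⋀ k ≤ ⋀ h ∨ g i
    joinand-join-meet i =
      ≤-trans (⋀-glb _ (λ j → ≤-trans (⋀-lb k (proj₁ (bound i j))) (proj₂ (bound i j))))
        (≤-trans (≡⇒≤ (sym (dfd (g i) h))) ∨-comm≤)

record LatticeLogic : Set₁ where
  infix 3 _⊢_
  infixr 6 _∨ᶠ_
  infixr 7 _∧ᶠ_
  field
    Fm : Set
    _⊢_ : Fm → Fm → Set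
    ⊤ᶠ ⊥ᶠ : Fm
    _∧ᶠ_ _∨ᶠ_ : Fm → Fm → Fm
    id⊢ : ∀ {a} → a ⊢ a
    cut : ∀ {a b c} → a ⊢ b → b ⊢ c → a ⊢ c
    ⊤-R : ∀ {a} → a ⊢ ⊤ᶠ
    ⊥-L : ∀ {a} → ⊥ᶠ ⊢ a
    ∧-L₁ : ∀ {a b} → a ∧ᶠ b ⊢ a
    ∧-L₂ : ∀ {a b} → a ∧ᶠ b ⊢ b
    ∧-R : ∀ {a b c} → c ⊢ a → c ⊢ b → c ⊢ a ∧ᶠ b
    ∨-R₁ : ∀ {a b} → a ⊢ a ∨ᶠ b
    ∨-R₂ : ∀ {a b} → b ⊢ a ∨ᶠ b
    ∨-L : ∀ {a b c} → a ⊢ c → b ⊢ c → a ∨ᶠ b ⊢ c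

module Pairs (A : CRL) (L : LatticeLogic) where
  open CRL A
  open ResiduatedFacts A
  open LatticeLogic L

  record IsPair (f u : Fm → Carrier) : Set where
    field
      f-resp : ∀ {a b} → a ⊢ b → b ⊢ a → f a ≡ f b
      u-resp : ∀ {a b} → a ⊢ b → b ⊢ a → u a ≡ u b
      f-⊤ : f ⊤ᶠ ≡ 1#
      f-⊥ : f ⊥ᶠ ≡ 0#
      f-∧ : ∀ a b → f (a ∧ᶠ b) ≡ f a ∧ f b
      u-⊥ : u ⊥ᶠ ≡ 0#
      u-⊤ : u ⊤ᶠ ≡ 1#
      u-∨ : ∀ a b → u (a ∨ᶠ b) ≡ u a ∨ u b
      f⇒u : ⋀ (λ π → f π ⇒ u π) ≡ 1#

  module _ {f u : Fm → Carrier} (P : IsPair f u) where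
    open IsPair P

    pair-≤ : ∀ π → f π ≤ u π
    pair-≤ π = 1≤⇒⇒≤ (≤-trans (≡⇒≤ (sym f⇒u)) (⋀-lb _ π))

    f-mono : ∀ {a b} → a ⊢ b → f a ≤ f b
    f-mono {a} {b} a⊢b =
      ≤-trans (≡⇒≤ (f-resp (∧-R id⊢ a⊢b) ∧-L₁)) (≤-trans (≡⇒≤ (f-∧ a b)) (∧-lb₂ _ _))

    u-mono : ∀ {a b} → a ⊢ b → u a ≤ u b
    u-mono {a} {b} a⊢b =
      ≤-trans (∨-ub₁ _ _) (≤-trans (≡⇒≤ (sym (u-∨ a b))) (≡⇒≤ (u-resp (∨-L a⊢b id⊢) ∨-R₂)))

  filterBelow : FrameDistributive A → ∀ {f u} → IsPair f u → (p : Fm) →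
                Σ (Fm → Carrier) (λ f' → IsPair f' u × u p ≤ f' p)
  filterBelow fd {u = u} P p = f' , f'-pair , ⋁-ub level (inj₁ id⊢)
    where
    open IsPair P

    Above : Fm → Set
    Above π = (p ⊢ π) ⊎ (⊤ᶠ ⊢ π)

    level : ∀ {π} → Above π → Carrier
    level (inj₁ _) = u p
    level (inj₂ _) = 1#

    f' : Fm → Carrier
    f' π = ⋁ (level {π})

    f'-mono : ∀ {a b} → a ⊢ b → f' a ≤ f' b
    f'-mono a⊢b = ⋁-lub _ λ { (inj₁ p⊢a) → ⋁-ub _ (inj₁ (cut p⊢a a⊢b))
                             ; (inj₂ ⊤⊢a) → ⋁-ub _ (inj₂ (cut ⊤⊢a a⊢b)) }

    f'≤u : ∀ π → f' π ≤ u π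
    f'≤u π = ⋁-lub _ λ { (inj₁ p⊢π) → u-mono P p⊢π
                        ; (inj₂ ⊤⊢π) → ≤-trans (≡⇒≤ (sym u-⊤)) (u-mono P ⊤⊢π) }

    f'-⊤ : f' ⊤ᶠ ≡ 1#
    f'-⊤ = ≤-antisym (≤-trans (f'≤u ⊤ᶠ) (≡⇒≤ u-⊤)) (⋁-ub _ (inj₂ id⊢))

    above-∧ : ∀ {a b} (i : Above a) (j : Above b) → Σ (Above (a ∧ᶠ b)) (λ k → level i ∧ level j ≤ level k)
    above-∧ (inj₁ p⊢a) (inj₁ p⊢b) = inj₁ (∧-R p⊢a p⊢b) , ∧-lb₁ _ _
    above-∧ (inj₁ p⊢a) (inj₂ ⊤⊢b) = inj₁ (∧-R p⊢a (cut ⊤-R ⊤⊢b)) , ∧-lb₁ _ _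
    above-∧ (inj₂ ⊤⊢a) (inj₁ p⊢b) = inj₁ (∧-R (cut ⊤-R ⊤⊢a) p⊢b) , ∧-lb₂ _ _
    above-∧ (inj₂ ⊤⊢a) (inj₂ ⊤⊢b) = inj₂ (∧-R ⊤⊢a ⊤⊢b) , ∧-lb₁ _ _

    f'-pair : IsPair f' u
    f'-pair = record
      { f-resp = λ a⊢b b⊢a → ≤-antisym (f'-mono a⊢b) (f'-mono b⊢a)
      ; u-resp = u-resp
      ; f-⊤ = f'-⊤
      ; f-⊥ = ≤-antisym (≤-trans (f'≤u ⊥ᶠ) (≡⇒≤ u-⊥)) (0-min _)
      ; f-∧ = λ a b → ≤-antisym (∧-glb (f'-mono ∧-L₁) (f'-mono ∧-L₂)) (⋁∧⋁≤⋁ fd above-∧)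
      ; u-⊥ = u-⊥
      ; u-⊤ = u-⊤
      ; u-∨ = u-∨
      ; f⇒u = ⋀⇒≡1 f'≤u ⊤ᶠ f'-⊤ u-⊤
      }

  -- Dually, the ideal generated by p at level f(p): u' π = ⋀ of 1, f(p) if
  -- π ⊢ p and 0 if π ⊢ ⊥ (the explicit 1 is needed since the top of A may
  -- exceed 1).
  coIdealAbove : DuallyFrameDistributive A → ∀ {f u} → IsPair f u → (p : Fm) →
                 Σ (Fm → Carrier) (λ u' → IsPair f u' × u' p ≤ f p)
  coIdealAbove dfd {f} P p = u' , u'-pair , ⋀-lb level (inj₂ (inj₁ id⊢))
    where
    open IsPair P

    Below : Fm → Set
    Below π = Unit ⊎ (π ⊢ p) ⊎ (π ⊢ ⊥ᶠ)

    level : ∀ {π} → Below π → Carrier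
    level (inj₁ _) = 1#
    level (inj₂ (inj₁ _)) = f p
    level (inj₂ (inj₂ _)) = 0#

    u' : Fm → Carrier
    u' π = ⋀ (level {π})

    u'-mono : ∀ {a b} → a ⊢ b → u' a ≤ u' b
    u'-mono a⊢b = ⋀-glb _ λ { (inj₁ t) → ⋀-lb _ (inj₁ t)
                             ; (inj₂ (inj₁ b⊢p)) → ⋀-lb _ (inj₂ (inj₁ (cut a⊢b b⊢p)))
                             ; (inj₂ (inj₂ b⊢⊥)) → ⋀-lb _ (inj₂ (inj₂ (cut a⊢b b⊢⊥))) }

    f≤u' : ∀ π → f π ≤ u' π
    f≤u' π = ⋀-glb _ λ { (inj₁ _) → ≤-trans (f-mono P ⊤-R) (≡⇒≤ f-⊤)
                        ; (inj₂ (inj₁ π⊢p)) → f-mono P π⊢p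
                        ; (inj₂ (inj₂ π⊢⊥)) → ≤-trans (f-mono P π⊢⊥) (≡⇒≤ f-⊥) }

    u'-⊤ : u' ⊤ᶠ ≡ 1#
    u'-⊤ = ≤-antisym (⋀-lb _ (inj₁ tt)) (≤-trans (≡⇒≤ (sym f-⊤)) (f≤u' ⊤ᶠ))

    below-∨ : ∀ {a b} (i : Below a) (j : Below b) → Σ (Below (a ∨ᶠ b)) (λ k → level k ≤ level i ∨ level j)
    below-∨ (inj₁ t) _ = inj₁ t , ∨-ub₁ _ _
    below-∨ (inj₂ _) (inj₁ t) = inj₁ t , ∨-ub₂ _ _
    below-∨ (inj₂ (inj₁ a⊢p)) (inj₂ (inj₁ b⊢p)) = inj₂ (inj₁ (∨-L a⊢p b⊢p)) , ∨-ub₁ _ _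
    below-∨ (inj₂ (inj₁ a⊢p)) (inj₂ (inj₂ b⊢⊥)) = inj₂ (inj₁ (∨-L a⊢p (cut b⊢⊥ ⊥-L))) , ∨-ub₁ _ _
    below-∨ (inj₂ (inj₂ a⊢⊥)) (inj₂ (inj₁ b⊢p)) = inj₂ (inj₁ (∨-L (cut a⊢⊥ ⊥-L) b⊢p)) , ∨-ub₂ _ _
    below-∨ (inj₂ (inj₂ a⊢⊥)) (inj₂ (inj₂ b⊢⊥)) = inj₂ (inj₂ (∨-L a⊢⊥ b⊢⊥)) , ∨-ub₁ _ _

    u'-pair : IsPair f u'
    u'-pair = record
      { f-resp = f-resp
      ; u-resp = λ a⊢b b⊢a → ≤-antisym (u'-mono a⊢b) (u'-mono b⊢a)
      ; f-⊤ = f-⊤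
      ; f-⊥ = f-⊥
      ; f-∧ = f-∧
      ; u-⊥ = ≤-antisym (⋀-lb _ (inj₂ (inj₂ id⊢))) (0-min _)
      ; u-⊤ = u'-⊤
      ; u-∨ = λ a b → ≤-antisym (⋀≤⋀∨⋀ dfd below-∨) (∨-lub (u'-mono ∨-R₁) (u'-mono ∨-R₂))
      ; f⇒u = ⋀⇒≡1 f≤u' ⊤ᶠ f-⊤ u'-⊤
      }

  module PointsOfPairs (fd : FrameDistributive A) (dfd : DuallyFrameDistributive A)
    (Z : Set) (fZ uZ : Z → Fm → Carrier) (isPair : ∀ z → IsPair (fZ z) (uZ z))
    (realise : ∀ {f u} → IsPair f u →
               Σ Z (λ z → (∀ π → fZ z π ≡ f π) × (∀ π → uZ z π ≡ u π)))
    where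

    E : Z → Z → Carrier
    E z z' = ⋀ (λ π → fZ z π ⇒ uZ z' π)

    pointBelow : ∀ z p → Σ Z (λ z' → 1# ≤ E z' z × uZ z p ≤ fZ z' p)
    pointBelow z p with filterBelow fd (isPair z) p
    ... | f' , f'-pair , up≤f'p with realise f'-pair
    ...   | z' , fZz'≡f' , uZz'≡uZz =
      z' , 1≤⋀⇒ fZz'≤uZz , ≤-trans up≤f'p (≡⇒≤ (sym (fZz'≡f' p)))
      where
      fZz'≤uZz : ∀ π → fZ z' π ≤ uZ z π
      fZz'≤uZz π = ≤-trans (pair-≤ (isPair z') π) (≡⇒≤ (uZz'≡uZz π))

    pointAbove : ∀ z p → Σ Z (λ z' → 1# ≤ E z z' × uZ z' p ≤ fZ z p)
    pointAbove z p with coIdealAbove dfd (isPair z) p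
    ... | u' , u'-pair , u'p≤fp with realise u'-pair
    ...   | z' , fZz'≡fZz , uZz'≡u' =
      z' , 1≤⋀⇒ fZz≤uZz' , ≤-trans (≡⇒≤ (uZz'≡u' p)) u'p≤fp
      where
      fZz≤uZz' : ∀ π → fZ z π ≤ uZ z' π
      fZz≤uZz' π = ≤-trans (≡⇒≤ (sym (fZz'≡fZz π))) (pair-≤ (isPair z') π)

    up1-val : ∀ p x → up1 A E (λ z → fZ z p) x ≡ uZ (proj₂ x) p ⇒ proj₁ x
    up1-val p (α , z) with pointBelow z p
    ... | z' , 1≤E , up≤fz'p = ≤-antisym
      (≤-trans (⋀-lb _ z') (≤-trans (⇒-monoʳ (⇒-discharge 1≤E)) (⇒-antitoneˡ up≤fz'p)))
      (⋀-glb _ (λ w → resid→ (resid→ (chain (⋀-lb (λ π → fZ w π ⇒ uZ z π) p)))))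

    down0-val : ∀ p z → fZ z p ≡ down0 A E (λ x → uZ (proj₂ x) p ⇒ proj₁ x) z
    down0-val p z with pointAbove z p
    ... | z' , 1≤E , uz'p≤fp = ≤-antisym
      (⋀-glb _ (λ { (α , w) → resid→ (resid→ (≤-trans (⊗-monoʳ (≡⇒≤ (⊗-comm _ _)))
                                                  (chain (⋀-lb (λ π → fZ z π ⇒ uZ w π) p)))) }))
      (≤-trans (⋀-lb _ (fZ z p , z'))
        (≤-trans (⇒-discharge (≤⇒1≤⇒ uz'p≤fp)) (⇒-discharge 1≤E)))

ppLogic : Set → LatticeLogic
ppLogic Prop = record
  { Fm = FmP Prop ; _⊢_ = _⊢P_ Prop ; ⊤ᶠ = ⊤P ; ⊥ᶠ = ⊥P ; _∧ᶠ_ = _∧P_ ; _∨ᶠ_ = _∨P_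
  ; id⊢ = idP ; cut = cutP ; ⊤-R = ⊤P-R ; ⊥-L = ⊥P-L ; ∧-L₁ = ∧P-L₁ ; ∧-L₂ = ∧P-L₂ ; ∧-R = ∧P-R
  ; ∨-R₁ = ∨P-R₁ ; ∨-R₂ = ∨P-R₂ ; ∨-L = ∨P-L }

sdLogic : Set → LatticeLogic
sdLogic Prop = record
  { Fm = FmS Prop ; _⊢_ = _⊢S_ Prop ; ⊤ᶠ = ⊤S ; ⊥ᶠ = ⊥S ; _∧ᶠ_ = _∧S_ ; _∨ᶠ_ = _∨S_
  ; id⊢ = idS ; cut = cutS ; ⊤-R = ⊤S-R ; ⊥-L = ⊥S-L ; ∧-L₁ = ∧S-L₁ ; ∧-L₂ = ∧S-L₂ ; ∧-R = ∧S-R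
  ; ∨-R₁ = ∨S-R₁ ; ∨-R₂ = ∨S-R₂ ; ∨-L = ∨S-L }

module CanonicalPoints (Prop : Set) (A : CRL) (fd : FrameDistributive A) (dfd : DuallyFrameDistributive A) where
  module PairsPP = Pairs A (ppLogic Prop)
  module PairsSD = Pairs A (sdLogic Prop)

  zsPair : (z : ZS Prop A) → PairsPP.IsPair (ZS.f z) (ZS.u z)
  zsPair z = record { ZS z }

  zsRealise : ∀ {f u} → PairsPP.IsPair f u →
              Σ (ZS Prop A) (λ z → (∀ π → ZS.f z π ≡ f π) × (∀ π → ZS.u z π ≡ u π))
  zsRealise {f} {u} P = record { f = f ; u = u ; PairsPP.IsPair P } , (λ _ → refl) , (λ _ → refl)

  zpPair : (z : ZP Prop A) → PairsSD.IsPair (ZP.g z) (ZP.v z)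
  zpPair z = record
    { f-resp = g-resp ; u-resp = v-resp ; f-⊤ = g-⊤ ; f-⊥ = g-⊥ ; f-∧ = g-∧
    ; u-⊥ = v-⊥ ; u-⊤ = v-⊤ ; u-∨ = v-∨ ; f⇒u = g⇒v }
    where open ZP z

  zpRealise : ∀ {g v} → PairsSD.IsPair g v →
              Σ (ZP Prop A) (λ z → (∀ σ → ZP.g z σ ≡ g σ) × (∀ σ → ZP.v z σ ≡ v σ))
  zpRealise {g} {v} P = zp , (λ _ → refl) , (λ _ → refl)
    where
    open PairsSD.IsPair P
    zp : ZP Prop A
    zp = record
      { g = g ; v = v ; g-resp = f-resp ; v-resp = u-resp ; g-⊤ = f-⊤ ; g-⊥ = f-⊥ ; g-∧ = f-∧
      ; v-⊥ = u-⊥ ; v-⊤ = u-⊤ ; v-∨ = u-∨ ; g⇒v = f⇒u }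

  module ZS-graph = PairsPP.PointsOfPairs fd dfd (ZS Prop A) ZS.f ZS.u zsPair zsRealise
  module ZP-graph = PairsSD.PointsOfPairs fd dfd (ZP Prop A) ZP.g ZP.v zpPair zpRealise

mainTheorem7 : (Prop : Set) (A : CRL) → FrameDistributive A → DuallyFrameDistributive A →
    (p : Prop) →
      (((x : CRL.Carrier A × ZS Prop A) → up1 A (ES Prop A) (valP Prop A p) x ≡ covalP Prop A p x)
        × ((z : ZS Prop A) → valP Prop A p z ≡ down0 A (ES Prop A) (covalP Prop A p) z))
      × (((x : CRL.Carrier A × ZP Prop A) → up1 A (EP Prop A) (valS Prop A p) x ≡ covalS Prop A p x)
        × ((z : ZP Prop A) → valS Prop A p z ≡ down0 A (EP Prop A) (covalS Prop A p) z))
mainTheorem7 Prop A fd dfd p =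
  (ZS-graph.up1-val (atP p) , ZS-graph.down0-val (atP p)) ,
  (ZP-graph.up1-val (atS p) , ZP-graph.down0-val (atS p))
  where open CanonicalPoints Prop A fd dfd
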